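{- Let $G=(V,E)$ be a graph with no universal vertices or true twins, and let $\{[l_u,r_u]\}_{u\in V}$ be a normalized circular-arc representation of $G$. Let $xy\in E$ and $z,w\in V$ be such that $l_x<l_z<l_y<l_w$. Then at least one of $z$, $w$ does not avoid the edge $xy$.
   Context: Graphs are finite with a loop at every vertex; $N[u]$ denotes the closed neighbourhood. A vertex is universal if $N[u]=V$; $u,v$ are true twins if $N[u]=N[v]$. An edge $uv$ is an inclusion edge if $N[u]\subseteq N[v]$ or $N[v]\subseteq N[u]$, otherwise an overlap edge; $x$ overlaps $y$ if $xy$ is an overlap edge. $\{u,v\}$ is a spanning pair if every $x\in V\setminus N[v]$ has $N[x]\subseteq N[u]$ and every $y\in V\setminus N[u]$ has $N[y]\subseteq N[v]$. An overlap edge $uv$ is a 2-overlap edge if $\{u,v\}$ is a spanning pair. For points on a circle, $p_1<p_2<\cdots<p_k$ means these points appear in this order when traversing the circle clockwise starting from $p_1$; $[p,q]$ is the clockwise arc from $p$ to $q$. A circular-arc representation of $G$ assigns to each $u$ an arc $[l_u,r_u]$ (left endpoint $l_u$, right endpoint $r_u$), all endpoints distinct, with $uv\in E$ iff the arcs intersect. It is normalized if for every edge $uv\in E$: (N1) $[l_u,r_u]$ properly contains $[l_v,r_v]$ iff $N[u]\supseteq N[v]$; (N2) $[l_u,r_u]\cup[l_v,r_v]$ covers the circle iff $uv$ is a 2-overlap edge. A vertex $z$ avoids an edge $xy$ (possibly $x=y$) if every neighbour of $z$ among $x,y$ overlaps $z$, and if $z$ overlaps both $x$ and $y$ then $x$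 and $y$ do not overlap each other. -}

module Defs where

open import Data.Nat using (ℕ; zero; suc; _+_; _*_; _∸_; _≤_; _<_; NonZero)
open import Data.Nat.DivMod using (_%_)
open import Data.Fin using (Fin; toℕ)
open import Data.Bool using (Bool; true)
open import Data.Product using (Σ; ∃; _×_)
open import Data.Empty using (⊥)
open import Data.Sum using (_⊎_)
open import Relation.Nullary using (¬_)
open import Relation.Binary.PropositionalEquality using (_≡_; _≢_)
open import Function.Bundles using (_⇔_)

record Graph (n : ℕ) : Set where
  field
    adj     : Fin n → Fin n → Bool
    adj-sym : ∀ u v → adj u v ≡ adj v u
    loop    : ∀ u → adj u u ≡ true

module _ {n : ℕ} (G : Graph n) where
  open Graph G

  -- uv ∈ E  (equivalently v ∈ N[u])
  Edge : Fin n → Fin n → Set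
  Edge u v = adj u v ≡ true

  _⊆N_ : Fin n → Fin n → Set
  u ⊆N v = ∀ w → Edge u w → Edge v w

  _≡N_ : Fin n → Fin n → Set
  u ≡N v = (u ⊆N v) × (v ⊆N u)

  Universal : Fin n → Set
  Universal u = ∀ v → Edge u v

  TrueTwins : Fin n → Fin n → Set
  TrueTwins u v = (u ≢ v) × (u ≡N v)

  NoUniversal : Set
  NoUniversal = ∀ u → ¬ Universal u

  NoTrueTwins : Set
  NoTrueTwins = ∀ u v → ¬ TrueTwins u v

  InclusionEdge : Fin n → Fin n → Set
  InclusionEdge u v = Edge u v × ((u ⊆N v) ⊎ (v ⊆N u))

  OverlapEdge : Fin n → Fin n → Set
  OverlapEdge u v = Edge u v × (¬ (u ⊆N v)) × (¬ (v ⊆N u))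

  SpanningPair : Fin n → Fin n → Set
  SpanningPair u v =
    (∀ x → ¬ Edge v x → x ⊆N u) × (∀ y → ¬ Edge u y → y ⊆N v)

  TwoOverlapEdge : Fin n → Fin n → Set
  TwoOverlapEdge u v = OverlapEdge u v × SpanningPair u v

  Avoids : Fin n → Fin n → Fin n → Set
  Avoids z x y =
    (Edge z x → OverlapEdge z x) ×
    (Edge z y → OverlapEdge z y) ×
    (OverlapEdge z x → OverlapEdge z y → ¬ OverlapEdge x y)

-- Endpoints of arcs are placed at positions 0..m (an
-- arbitrary finite set of positions on the circle, in clockwise order).
-- To represent the continuum of the circle faithfully we work in
-- "doubled coordinates": the circle is ℤ / (2(m+1)), endpoint position
-- e sits at point 2e, and the odd points represent the open gaps
-- between consecutive endpoint positions.  Since all arcs are closed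
-- with endpoints at even points, two arcs intersect (resp. cover the
-- circle) in the continuum iff they do so on these discrete points.

Pts : ℕ → ℕ
Pts m = suc m + suc m

cw : (K : ℕ) → .{{ _ : NonZero K }} → ℕ → ℕ → ℕ
cw K a b = (b + K ∸ a) % K

cwd : ℕ → ℕ → ℕ → ℕ
cwd m a b = cw (Pts m) a b

dbl : {m : ℕ} → Fin (suc m) → ℕ
dbl e = 2 * toℕ e

InArc : (m : ℕ) → Fin (suc m) → Fin (suc m) → ℕ → Set
InArc m a b p = cwd m (dbl a) p ≤ cwd m (dbl a) (dbl b)

-- cyclic order p₁ < p₂ < p₃ < p₄ of endpoint positions: they appear in
-- this order traversing the circle clockwise starting from p₁
CycOrd4 : (m : ℕ) → (p₁ p₂ p₃ p₄ : Fin (suc m)) → Set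
CycOrd4 m p₁ p₂ p₃ p₄ =
  (0 < cwd m (dbl p₁) (dbl p₂)) ×
  (cwd m (dbl p₁) (dbl p₂) < cwd m (dbl p₁) (dbl p₃)) ×
  (cwd m (dbl p₁) (dbl p₃) < cwd m (dbl p₁) (dbl p₄))

record CARep {n : ℕ} (G : Graph n) : Set where
  field
    m : ℕ
    l : Fin n → Fin (suc m)
    r : Fin n → Fin (suc m)
    l-inj : ∀ u v → l u ≡ l v → u ≡ v
    r-inj : ∀ u v → r u ≡ r v → u ≡ v
    l≢r   : ∀ u v → l u ≢ r v
    represents : ∀ u v →
      Edge G u v ⇔ (Σ ℕ λ p → (p < Pts m) × InArc m (l u) (r u) p × InArc m (l v) (r v) p)

  Arc : Fin n → ℕ → Set
  Arc u p = InArc m (l u) (r u) p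

  ProperlyContains : Fin n → Fin n → Set
  ProperlyContains u v =
    (∀ p → p < Pts m → Arc v p → Arc u p) ×
    (Σ ℕ λ p → (p < Pts m) × Arc u p × ¬ Arc v p)

  Covers : Fin n → Fin n → Set
  Covers u v = ∀ p → p < Pts m → (Arc u p ⊎ Arc v p)

  Normalized : Set
  Normalized = ∀ u v → Edge G u v → u ≢ v →
    (ProperlyContains u v ⇔ _⊆N_ G v u) ×
    (Covers u v ⇔ TwoOverlapEdge G u v)

-- Measure positions clockwise from l_x.  The arc of x becomes the interval
-- [0, r_x], and the hypothesis reads 0 < l_z < l_y < l_w.
-- If l_y ≤ r_x: a vertex z avoiding xy overlaps x, so by (N1) its arc reaches
-- r_x and therefore meets y; then z overlaps y, and (N1), (N2) force xy to be
-- an overlap edge, which avoidance forbids.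
-- If r_x < l_y: the arc of y wraps through 0.  A vertex w avoiding xy overlaps
-- y, so by (N1) its arc wraps beyond r_y; it then meets x, overlaps it, and
-- again xy is forced to be an overlap edge.
module Submission where

open import Defs
open import Data.Nat using (ℕ; suc; _+_; _*_; _∸_; _≤_; _<_; _≤?_; z≤n; NonZero; >-nonZero⁻¹)
open import Data.Nat.Properties hiding (_≟_)
open import Data.Nat.DivMod using (_%_; _/_; m%n<n; m<n⇒m%n≡m; [m+kn]%n≡m%n; m≡m%n+[m/n]*n)
open import Algebra.Properties.CommutativeSemigroup +-commutativeSemigroup using (xy∙z≈xz∙y)
open import Data.Fin using (Fin; toℕ; _≟_)
open import Data.Fin.Properties using (toℕ<n)
open import Data.Product using (∃; ∃₂; _×_; _,_; proj₁; proj₂)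
open import Data.Sum using (_⊎_; inj₁; inj₂; map)
open import Data.Empty using (⊥-elim)
open import Relation.Nullary using (¬_; yes; no)
open import Relation.Binary.PropositionalEquality
open import Function.Base using (case_of_)
open import Function.Bundles using (_⇔_; mk⇔; Equivalence)

open Equivalence using (to; from)

infix 4 _≡_[mod_]
_≡_[mod_] : ℕ → ℕ → ℕ → Set
x ≡ y [mod K ] = ∃₂ λ i j → x + i * K ≡ y + j * K

module _ {K : ℕ} where

  ≡⇒≡[mod] : ∀ {x y} → x ≡ y → x ≡ y [mod K ]
  ≡⇒≡[mod] refl = 0 , 0 , refl

  ≡[mod]-sym : ∀ {x y} → x ≡ y [mod K ] → y ≡ x [mod K ]
  ≡[mod]-sym (i , j , e) = j , i , sym e

  ≡[mod]-trans : ∀ {x y z} → x ≡ y [mod K ] → y ≡ z [mod K ] → x ≡ z [mod K ]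
  ≡[mod]-trans {x} {y} {z} (i , j , p) (i′ , j′ , q) = i + i′ , j′ + j , (begin
    x + (i + i′) * K      ≡⟨ +-*-distrib x i i′ ⟩
    (x + i * K) + i′ * K  ≡⟨ cong (_+ i′ * K) p ⟩
    (y + j * K) + i′ * K  ≡⟨ xy∙z≈xz∙y y (j * K) (i′ * K) ⟩
    (y + i′ * K) + j * K  ≡⟨ cong (_+ j * K) q ⟩
    (z + j′ * K) + j * K  ≡⟨ +-*-distrib z j′ j ⟨
    z + (j′ + j) * K      ∎)
    where
    open ≡-Reasoning
    +-*-distrib : ∀ a b c → a + (b + c) * K ≡ (a + b * K) + c * K
    +-*-distrib a b c = trans (cong (a +_) (*-distribʳ-+ K b c)) (sym (+-assoc a (b * K) (c * K)))

  ≡[mod]-+ʳ : ∀ {x y} c → x ≡ y [mod K ] → x + c ≡ y + c [mod K ]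
  ≡[mod]-+ʳ {x} {y} c (i , j , e) =
    i , j , trans (xy∙z≈xz∙y x c (i * K)) (trans (cong (_+ c) e) (xy∙z≈xz∙y y (j * K) c))

  ≡[mod]-cancelˡ : ∀ a {x y} → a + x ≡ a + y [mod K ] → x ≡ y [mod K ]
  ≡[mod]-cancelˡ a {x} {y} (i , j , e) =
    i , j , +-cancelˡ-≡ a _ _ (trans (sym (+-assoc a x (i * K))) (trans e (+-assoc a y (j * K))))

  +K≡[mod] : ∀ x → x + K ≡ x [mod K ]
  +K≡[mod] x = 0 , 1 , trans (+-identityʳ (x + K)) (cong (x +_) (sym (*-identityˡ K)))

module _ {K : ℕ} .{{_ : NonZero K}} where

  ≡[mod]⇒≡ : ∀ {x y} → x < K → y < K → x ≡ y [mod K ] → x ≡ y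
  ≡[mod]⇒≡ {x} {y} x<K y<K (i , j , e) = begin
    x                ≡⟨ m<n⇒m%n≡m x<K ⟨
    x % K            ≡⟨ [m+kn]%n≡m%n x i K ⟨
    (x + i * K) % K  ≡⟨ cong (_% K) e ⟩
    (y + j * K) % K  ≡⟨ [m+kn]%n≡m%n y j K ⟩
    y % K            ≡⟨ m<n⇒m%n≡m y<K ⟩
    y                ∎
    where open ≡-Reasoning

  cw<K : ∀ a b → cw K a b < K
  cw<K a b = m%n<n (b + K ∸ a) K

  +cw≡[mod] : ∀ {a} b → a ≤ K → a + cw K a b ≡ b [mod K ]
  +cw≡[mod] {a} b a≤K = q / K , 1 , (begin
    a + q % K + q / K * K    ≡⟨ +-assoc a (q % K) (q / K * K) ⟩
    a + (q % K + q / K * K)  ≡⟨ cong (a +_) (m≡m%n+[m/n]*n q K) ⟨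
    a + q                    ≡⟨ m+[n∸m]≡n (≤-trans a≤K (m≤n+m K b)) ⟩
    b + K                    ≡⟨ cong (b +_) (*-identityˡ K) ⟨
    b + 1 * K                ∎)
    where
    open ≡-Reasoning
    q = b + K ∸ a

  cw-unique : ∀ {a b r} → a ≤ K → r < K → a + r ≡ b [mod K ] → cw K a b ≡ r
  cw-unique {a} {b} a≤K r<K a+r≡b = ≡[mod]⇒≡ (cw<K a b) r<K
    (≡[mod]-cancelˡ a (≡[mod]-trans (+cw≡[mod] b a≤K) (≡[mod]-sym a+r≡b)))

  cw-self : ∀ {a} → a ≤ K → cw K a a ≡ 0
  cw-self {a} a≤K = cw-unique a≤K (>-nonZero⁻¹ K) (≡⇒≡[mod] (+-identityʳ a))

  cw-rotate : ∀ {a b c} → a ≤ K → b ≤ K → cw K (cw K a b) (cw K a c) ≡ cw K b c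
  cw-rotate {a} {b} {c} a≤K b≤K = cw-unique (<⇒≤ (cw<K a b)) (cw<K b c)
    (≡[mod]-cancelˡ a
      (≡[mod]-trans (≡⇒≡[mod] (sym (+-assoc a (cw K a b) (cw K b c))))
      (≡[mod]-trans (≡[mod]-+ʳ (cw K b c) (+cw≡[mod] b a≤K))
      (≡[mod]-trans (+cw≡[mod] c b≤K)
                    (≡[mod]-sym (+cw≡[mod] c a≤K))))))

  +cw-≤ : ∀ {a b} → a ≤ b → b < K → a + cw K a b ≡ b
  +cw-≤ {a} {b} a≤b b<K = trans (cong (a +_) cw≡b∸a) (m+[n∸m]≡n a≤b)
    where
    cw≡b∸a : cw K a b ≡ b ∸ a
    cw≡b∸a = cw-unique (≤-trans a≤b (<⇒≤ b<K)) (≤-<-trans (m∸n≤m b a) b<K)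
                       (≡⇒≡[mod] (m+[n∸m]≡n a≤b))

  +cw-> : ∀ {a b} → b < a → a ≤ K → a + cw K a b ≡ b + K
  +cw-> {a} {b} b<a a≤K = trans (cong (a +_) cw≡b+K∸a) a+[b+K∸a]≡b+K
    where
    a+[b+K∸a]≡b+K : a + (b + K ∸ a) ≡ b + K
    a+[b+K∸a]≡b+K = m+[n∸m]≡n (≤-trans a≤K (m≤n+m K b))
    b+K∸a<K : b + K ∸ a < K
    b+K∸a<K = subst (b + K ∸ a <_) (m+n∸m≡n a K)
                    (∸-monoˡ-< (+-monoˡ-< K b<a) (≤-trans a≤K (m≤n+m K b)))
    cw≡b+K∸a : cw K a b ≡ b + K ∸ a
    cw≡b+K∸a = cw-unique a≤K b+K∸a<K
                 (≡[mod]-trans (≡⇒≡[mod] a+[b+K∸a]≡b+K) (+K≡[mod] b))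

OnArc : ℕ → ℕ → ℕ → Set
OnArc A B P = (A ≤ B × A ≤ P × P ≤ B) ⊎ (B < A × (A ≤ P ⊎ P ≤ B))

OnArc-start : ∀ A B → OnArc A B A
OnArc-start A B with A ≤? B
... | yes A≤B = inj₁ (A≤B , ≤-refl , A≤B)
... | no A≰B  = inj₂ (≰⇒> A≰B , inj₁ ≤-refl)

OnArc-end : ∀ A B → OnArc A B B
OnArc-end A B with A ≤? B
... | yes A≤B = inj₁ (A≤B , A≤B , ≤-refl)
... | no A≰B  = inj₂ (≰⇒> A≰B , inj₂ ≤-refl)

OnArc-before : ∀ {A B P} → A ≤ B → P < A → ¬ OnArc A B P
OnArc-before A≤B P<A (inj₁ (_ , A≤P , _)) = <⇒≱ P<A A≤P
OnArc-before A≤B P<A (inj₂ (B<A , _))     = <⇒≱ B<A A≤B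

OnArc-gap : ∀ {A B P} → B < P → P < A → ¬ OnArc A B P
OnArc-gap B<P P<A (inj₁ (A≤B , _))           = <⇒≱ (<-trans B<P P<A) A≤B
OnArc-gap B<P P<A (inj₂ (_ , inj₁ A≤P))      = <⇒≱ P<A A≤P
OnArc-gap B<P P<A (inj₂ (_ , inj₂ P≤B))      = <⇒≱ B<P P≤B

≤-via-+ˡ : ∀ {a r s X Y} → a + r ≡ X → a + s ≡ Y → r ≤ s ⇔ X ≤ Y
≤-via-+ˡ {a} refl refl = mk⇔ (+-monoʳ-≤ a) (+-cancelˡ-≤ a _ _)

cw≤⇔OnArc : ∀ {K A B P} .{{_ : NonZero K}} → A < K → B < K → P < K →
            cw K A P ≤ cw K A B ⇔ OnArc A B P
cw≤⇔OnArc {K} {A} {B} {P} A<K B<K P<K with A ≤? B | A ≤? P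
... | yes A≤B | yes A≤P = mk⇔
  (λ le → inj₁ (A≤B , A≤P , to (≤-via-+ˡ (+cw-≤ A≤P P<K) (+cw-≤ A≤B B<K)) le))
  λ { (inj₁ (_ , _ , P≤B)) → from (≤-via-+ˡ (+cw-≤ A≤P P<K) (+cw-≤ A≤B B<K)) P≤B
    ; (inj₂ (B<A , _)) → ⊥-elim (<⇒≱ B<A A≤B) }
... | yes A≤B | no A≰P = mk⇔
  (λ le → ⊥-elim (<⇒≱ B<K (≤-trans (m≤n+m K P)
            (to (≤-via-+ˡ (+cw-> (≰⇒> A≰P) (<⇒≤ A<K)) (+cw-≤ A≤B B<K)) le))))
  λ { (inj₁ (_ , A≤P , _)) → ⊥-elim (A≰P A≤P)
    ; (inj₂ (B<A , _)) → ⊥-elim (<⇒≱ B<A A≤B) }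
... | no A≰B | yes A≤P = mk⇔
  (λ _ → inj₂ (≰⇒> A≰B , inj₁ A≤P))
  (λ _ → from (≤-via-+ˡ (+cw-≤ A≤P P<K) (+cw-> (≰⇒> A≰B) (<⇒≤ A<K)))
               (≤-trans (<⇒≤ P<K) (m≤n+m K B)))
... | no A≰B | no A≰P = mk⇔
  (λ le → inj₂ (≰⇒> A≰B , inj₂ (+-cancelʳ-≤ K P B
            (to (≤-via-+ˡ (+cw-> (≰⇒> A≰P) (<⇒≤ A<K)) (+cw-> (≰⇒> A≰B) (<⇒≤ A<K))) le))))
  λ { (inj₁ (A≤B , _)) → ⊥-elim (A≰B A≤B)
    ; (inj₂ (_ , inj₁ A≤P)) → ⊥-elim (A≰P A≤P)
    ; (inj₂ (_ , inj₂ P≤B)) → from (≤-via-+ˡ (+cw-> (≰⇒> A≰P) (<⇒≤ A<K)) (+cw-> (≰⇒> A≰B) (<⇒≤ A<K)))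
                                   (+-monoˡ-≤ K P≤B) }

module MeasuredFromLeftOf {n : ℕ} (G : Graph n) (R : CARep G) (normalized : CARep.Normalized R)
                          (x : Fin n) where
  open CARep R

  K : ℕ
  K = Pts m

  _⊆_ : Fin n → Fin n → Set
  u ⊆ v = _⊆N_ G u v

  Edge-sym : ∀ {u v} → Edge G u v → Edge G v u
  Edge-sym {u} {v} e = trans (Graph.adj-sym G v u) e

  dbl<K : (e : Fin (suc m)) → dbl e < K
  dbl<K e = +-mono-< (toℕ<n e) (subst (_< suc m) (sym (+-identityʳ (toℕ e))) (toℕ<n e))

  θ : ℕ → ℕ
  θ = cw K (dbl (l x))

  θ<K : ∀ p → θ p < K
  θ<K = cw<K (dbl (l x))

  left right : Fin n → ℕ
  left u  = θ (dbl (l u))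
  right u = θ (dbl (r u))

  On : Fin n → ℕ → Set
  On u = OnArc (left u) (right u)

  Arc⇔On : ∀ u {p} → p < K → Arc u p ⇔ On u (θ p)
  Arc⇔On u {p} p<K =
    subst₂ (λ a b → a ≤ b ⇔ On u (θ p))
      (cw-rotate {c = p} lx≤K lu≤K) (cw-rotate {c = dbl (r u)} lx≤K lu≤K)
      (cw≤⇔OnArc {A = left u} {right u} {θ p} (θ<K _) (θ<K _) (θ<K p))
    where
    lx≤K = <⇒≤ (dbl<K (l x))
    lu≤K = <⇒≤ (dbl<K (l u))

  left-x≡0 : left x ≡ 0
  left-x≡0 = cw-self (<⇒≤ (dbl<K (l x)))

  On-left : ∀ u → On u (left u)
  On-left u = OnArc-start (left u) (right u)

  On-right : ∀ u → On u (right u)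
  On-right u = OnArc-end (left u) (right u)

  left-x≤ : ∀ P → left x ≤ P
  left-x≤ P = subst (_≤ P) (sym left-x≡0) z≤n

  On-x⁺ : ∀ {P} → P ≤ right x → On x P
  On-x⁺ {P} P≤rx = inj₁ (left-x≤ (right x) , left-x≤ P , P≤rx)

  On-x⁻ : ∀ {P} → On x P → P ≤ right x
  On-x⁻ (inj₁ (_ , _ , P≤rx)) = P≤rx
  On-x⁻ (inj₂ (rx<lx , _))    = ⊥-elim (<⇒≱ rx<lx (left-x≤ (right x)))

  meets : ∀ {u v} → Edge G u v → ∃ λ p → p < K × On u (θ p) × On v (θ p)
  meets {u} {v} e with to (represents u v) e
  ... | p , p<K , on-u , on-v = p , p<K , to (Arc⇔On u p<K) on-u , to (Arc⇔On v p<K) on-v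

  meets-at-left : ∀ {u v} → On v (left u) → Edge G u v
  meets-at-left {u} {v} on-v = from (represents u v)
    (dbl (l u) , dbl<K (l u) , from (Arc⇔On u (dbl<K (l u))) (On-left u)
                             , from (Arc⇔On v (dbl<K (l u))) on-v)

  ArcInside : Fin n → Fin n → Set
  ArcInside v u = ∀ {p} → p < K → On v (θ p) → On u (θ p)

  ⊆⇒ArcInside : ∀ {u v} → Edge G u v → v ⊆ u → ArcInside v u
  ⊆⇒ArcInside {u} {v} e v⊆u with u ≟ v
  ... | yes refl = λ _ on-v → on-v
  ... | no u≢v   = λ p<K on-v → to (Arc⇔On u p<K)
    (proj₁ (from (proj₁ (normalized u v e u≢v)) v⊆u) _ p<K (from (Arc⇔On v p<K) on-v))

  ArcInside⇒⊆ : ∀ {u v} → Edge G u v → ArcInside v u → ¬ On v (left u) → v ⊆ u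
  ArcInside⇒⊆ {u} {v} e inside left-u∉v = to (proj₁ (normalized u v e u≢v))
    ( (λ p p<K a → from (Arc⇔On u p<K) (inside p<K (to (Arc⇔On v p<K) a)))
    , dbl (l u) , dbl<K (l u) , from (Arc⇔On u (dbl<K (l u))) (On-left u)
    , λ a → left-u∉v (to (Arc⇔On v (dbl<K (l u))) a) )
    where
    u≢v : u ≢ v
    u≢v refl = left-u∉v (On-left u)

  covering⇒overlap : ∀ {u v} → Edge G u v → u ≢ v → (∀ P → On u P ⊎ On v P) → OverlapEdge G u v
  covering⇒overlap {u} {v} e u≢v covering = proj₁ (to (proj₂ (normalized u v e u≢v))
    λ p p<K → map (from (Arc⇔On u p<K)) (from (Arc⇔On v p<K)) (covering (θ p)))

  reaches-right-of-x : ∀ {u} → ¬ u ⊆ x → 0 < left u → left u ≤ right x →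
                       ∀ {P} → left u ≤ P → P ≤ right x → On u P
  reaches-right-of-x {u} u⊈x 0<lu lu≤rx {P} lu≤P P≤rx
    with left u ≤? right u | right x ≤? right u
  ... | no lu≰ru  | _         = inj₂ (≰⇒> lu≰ru , inj₁ lu≤P)
  ... | yes lu≤ru | yes rx≤ru = inj₁ (lu≤ru , lu≤P , ≤-trans P≤rx rx≤ru)
  ... | yes lu≤ru | no rx≰ru  = ⊥-elim (u⊈x (ArcInside⇒⊆ (Edge-sym (meets-at-left (On-x⁺ lu≤rx)))
                                                          u-inside-x left-x∉u))
    where
    u-inside-x : ArcInside u x
    u-inside-x _ (inj₁ (_ , _ , P≤ru)) = On-x⁺ (≤-trans P≤ru (<⇒≤ (≰⇒> rx≰ru)))
    u-inside-x _ (inj₂ (ru<lu , _))    = ⊥-elim (<⇒≱ ru<lu lu≤ru)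
    left-x∉u : ¬ On u (left x)
    left-x∉u on = OnArc-before lu≤ru 0<lu (subst (On u) left-x≡0 on)

  ¬Avoids-if-y-starts-on-x : ∀ {y z} → Edge G x y → 0 < left z → left z < left y → left y ≤ right x →
            ¬ Avoids G z x y
  ¬Avoids-if-y-starts-on-x {y} {z} xy 0<lz lz<ly ly≤rx (avoid-x , avoid-y , no-overlap) =
    no-overlap zx-overlap zy-overlap xy-overlap
    where
    lz≤rx : left z ≤ right x
    lz≤rx = ≤-trans (<⇒≤ lz<ly) ly≤rx
    zx-overlap : OverlapEdge G z x
    zx-overlap = avoid-x (meets-at-left (On-x⁺ lz≤rx))
    z-reaches : ∀ {P} → left z ≤ P → P ≤ right x → On z P
    z-reaches = reaches-right-of-x (proj₁ (proj₂ zx-overlap)) 0<lz lz≤rx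
    zy-overlap : OverlapEdge G z y
    zy-overlap = avoid-y (Edge-sym (meets-at-left (z-reaches (<⇒≤ lz<ly) ly≤rx)))
    x≢y : x ≢ y
    x≢y refl = <⇒≱ (<-trans 0<lz lz<ly) (≤-reflexive left-x≡0)
    xy-overlap : OverlapEdge G x y
    xy-overlap with left y ≤? right y
    ... | no ly≰ry = covering⇒overlap xy x≢y λ P → case P ≤? right x of λ where
          (yes P≤rx) → inj₁ (On-x⁺ P≤rx)
          (no P≰rx)  → inj₂ (inj₂ (≰⇒> ly≰ry , inj₁ (≤-trans ly≤rx (<⇒≤ (≰⇒> P≰rx)))))
    ... | yes ly≤ry = xy , x⊈y , y⊈x
      where
      x⊈y : ¬ x ⊆ y
      x⊈y x⊆y = OnArc-before ly≤ry (<-trans 0<lz lz<ly)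
        (subst (On y) left-x≡0 (⊆⇒ArcInside (Edge-sym xy) x⊆y (dbl<K (l x)) (On-left x)))
      y⊈x : ¬ y ⊆ x
      y⊈x y⊆x = proj₂ (proj₂ zy-overlap)
        (ArcInside⇒⊆ (proj₁ zy-overlap) y-inside-z (OnArc-before ly≤ry lz<ly))
        where
        ry≤rx : right y ≤ right x
        ry≤rx = On-x⁻ (⊆⇒ArcInside xy y⊆x (dbl<K (r y)) (On-right y))
        y-inside-z : ArcInside y z
        y-inside-z _ (inj₁ (_ , ly≤P , P≤ry)) = z-reaches (≤-trans (<⇒≤ lz<ly) ly≤P) (≤-trans P≤ry ry≤rx)
        y-inside-z _ (inj₂ (ry<ly , _))      = ⊥-elim (<⇒≱ ry<ly ly≤ry)

  ¬Avoids-if-y-starts-after-x : ∀ {y w} → Edge G x y → right x < left y → left y < left w → ¬ Avoids G w x y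
  ¬Avoids-if-y-starts-after-x {y} {w} xy rx<ly ly<lw (avoid-x , avoid-y , no-overlap) =
    no-overlap wx-overlap wy-overlap (xy , x⊈y , y⊈x)
    where
    y-wraps : right y < left y
    y-wraps with meets xy
    ... | _ , _ , on-x , inj₁ (_ , ly≤P , _) = ⊥-elim (<⇒≱ rx<ly (≤-trans ly≤P (On-x⁻ on-x)))
    ... | _ , _ , _    , inj₂ (ry<ly , _)    = ry<ly
    wy-overlap : OverlapEdge G w y
    wy-overlap = avoid-y (meets-at-left (inj₂ (y-wraps , inj₁ (<⇒≤ ly<lw))))
    w-inside-y : left w ≤ right w ⊎ right w ≤ right y → ArcInside w y
    w-inside-y _             _ (inj₁ (_ , lw≤P , _))  = inj₂ (y-wraps , inj₁ (≤-trans (<⇒≤ ly<lw) lw≤P))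
    w-inside-y _             _ (inj₂ (_ , inj₁ lw≤P)) = inj₂ (y-wraps , inj₁ (≤-trans (<⇒≤ ly<lw) lw≤P))
    w-inside-y (inj₁ lw≤rw) _ (inj₂ (rw<lw , inj₂ _)) = ⊥-elim (<⇒≱ rw<lw lw≤rw)
    w-inside-y (inj₂ rw≤ry) _ (inj₂ (_ , inj₂ P≤rw))  = inj₂ (y-wraps , inj₂ (≤-trans P≤rw rw≤ry))
    left-y∉w : left w ≤ right w ⊎ right w ≤ right y → ¬ On w (left y)
    left-y∉w (inj₁ lw≤rw) = OnArc-before lw≤rw ly<lw
    left-y∉w (inj₂ rw≤ry) = OnArc-gap (≤-<-trans rw≤ry y-wraps) ly<lw
    w⊈y : ¬ (left w ≤ right w ⊎ right w ≤ right y)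
    w⊈y h = proj₁ (proj₂ wy-overlap)
      (ArcInside⇒⊆ (Edge-sym (proj₁ wy-overlap)) (w-inside-y h) (left-y∉w h))
    w-wraps-beyond-y : right w < left w × right y < right w
    w-wraps-beyond-y with left w ≤? right w | right w ≤? right y
    ... | yes lw≤rw | _         = ⊥-elim (w⊈y (inj₁ lw≤rw))
    ... | _         | yes rw≤ry = ⊥-elim (w⊈y (inj₂ rw≤ry))
    ... | no lw≰rw  | no rw≰ry  = ≰⇒> lw≰rw , ≰⇒> rw≰ry
    wx-overlap : OverlapEdge G w x
    wx-overlap = avoid-x (Edge-sym (meets-at-left
      (subst (On w) (sym left-x≡0) (inj₂ (proj₁ w-wraps-beyond-y , inj₂ z≤n)))))
    y⊈x : ¬ y ⊆ x
    y⊈x y⊆x = <⇒≱ rx<ly (On-x⁻ (⊆⇒ArcInside xy y⊆x (dbl<K (l y)) (On-left y)))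
    x⊈y : ¬ x ⊆ y
    x⊈y x⊆y with ⊆⇒ArcInside (Edge-sym xy) x⊆y (dbl<K (r x)) (On-right x)
    ... | inj₁ (ly≤ry , _)      = <⇒≱ y-wraps ly≤ry
    ... | inj₂ (_ , inj₁ ly≤rx) = <⇒≱ rx<ly ly≤rx
    ... | inj₂ (_ , inj₂ rx≤ry) =
      proj₂ (proj₂ wx-overlap) (ArcInside⇒⊆ (proj₁ wx-overlap) x-inside-w left-w∉x)
      where
      x-inside-w : ArcInside x w
      x-inside-w _ on-x = inj₂ (proj₁ w-wraps-beyond-y ,
        inj₂ (≤-trans (On-x⁻ on-x) (≤-trans rx≤ry (<⇒≤ (proj₂ w-wraps-beyond-y)))))
      left-w∉x : ¬ On x (left w)
      left-w∉x on-x = <⇒≱ (<-trans rx<ly ly<lw) (On-x⁻ on-x)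

lemma8 : {n : ℕ} (G : Graph n) → NoUniversal G → NoTrueTwins G →
    (R : CARep G) → CARep.Normalized R →
    (x y z w : Fin n) → Edge G x y →
    CycOrd4 (CARep.m R) (CARep.l R x) (CARep.l R z) (CARep.l R y) (CARep.l R w) →
    (¬ Avoids G z x y) ⊎ (¬ Avoids G w x y)
lemma8 G _ _ R normalized x y z w xy (0<lz , lz<ly , ly<lw) = case left y ≤? right x of λ where
    (yes ly≤rx) → inj₁ (¬Avoids-if-y-starts-on-x xy 0<lz lz<ly ly≤rx)
    (no ly≰rx)  → inj₂ (¬Avoids-if-y-starts-after-x xy (≰⇒> ly≰rx) ly<lw)
  where open MeasuredFromLeftOf G R normalized x
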